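{- Let $P_{3,1}$ be the straight tromino (three unit squares in a $1\times3$ row) and $P_{3,2}$ the L-tromino (a $2\times2$ square with one unit square removed). Then $\tau(P_{3,1})=\tau(P_{3,2})=(1,7,\infty)$, i.e. each of them is a $(1,1)$-winner, a $(1,2)$-loser, a $(2,7)$-winner, a $(2,8)$-loser, and an $(n,b)$-winner for all $n\ge3$ and all $b\ge0$.
   Context: The board is the tiling of the plane by unit squares (cells); cells are adjacent if they share an edge. A polyomino is a finite connected set of cells up to congruence. In the weak $(a,b)$ achievement game ($a\ge1,b\ge0$) for a goal polyomino $A$ on the infinite board, maker and breaker alternately mark previously unmarked cells, maker first, $a$ resp. $b$ cells per turn; the maker wins if his marked cells at some point contain a set congruent to $A$; $A$ is an $(a,b)$-winner if the maker has a strategy guaranteeing a win in finitely many turns against every breaker play, otherwise an $(a,b)$-loser. The threshold sequence $\tau(A)=(b_1,b_2,\ldots)$ has $b_n$ the greatest $b$ for which $A$ is an $(n,b)$-winner ($\infty$ if for all $b$); $(b_1,\ldots,b_{k-1},\infty)$ denotes the sequence with $b_n=\infty$ for all $n\ge k$. -}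

module Defs where

open import Data.Bool using (Bool; true; false; if_then_else_)
open import Data.Nat using (ℕ)
open import Data.Integer using (ℤ; +_; -_; _+_)
open import Data.Product using (_×_; _,_; Σ; ∃; ∃-syntax)
open import Data.Sum using (_⊎_)
open import Data.List using (List; []; _∷_; _++_; length)
open import Data.List.Relation.Unary.All using (All)
open import Data.List.Relation.Unary.Unique.Propositional using (Unique)
open import Data.List.Membership.Propositional using (_∈_; _∉_)
open import Relation.Binary.PropositionalEquality using (_≡_)

-- A cell of the infinite board is a point of ℤ²; cells (x,y),(x',y') are
-- adjacent iff they differ by 1 in exactly one coordinate.
Cell : Set
Cell = ℤ × ℤ

-- The 8 linear isometries of ℤ² fixing the origin (dihedral group D4):
-- optionally swap the coordinates, then optionally negate each coordinate.
record Orientation : Set where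
  constructor orient
  field
    swap negX negY : Bool

-- Congruence map of the plane grid: orientation followed by translation.
-- Every isometry of ℤ² (mapping cells to cells) is of this form.
applyIso : Orientation → Cell → Cell → Cell
applyIso (orient s nx ny) (tx , ty) (x , y) =
  let u = if s then y else x
      v = if s then x else y
  in ((if nx then - u else u) + tx , (if ny then - v else v) + ty)

-- The set of cells S contains a set congruent to the polyomino A
-- (A given by a list of its cells).
ContainsCopy : List Cell → List Cell → Set
ContainsCopy A S = Σ Orientation λ g → Σ Cell λ t → All (λ c → applyIso g t c ∈ S) A

ValidMove : ℕ → List Cell → List Cell → Set
ValidMove k marked mv = (length mv ≡ k) × Unique mv × All (λ c → c ∉ marked) mv

-- MakerWins a b A M B : in the weak (a,b) achievement game for goal A, from
-- the position where maker has marked M and breaker has marked B, with maker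
-- to move, maker has a strategy that wins in finitely many turns against
-- every breaker play.  (Inductive, i.e. well-founded game tree.)
data MakerWins (a b : ℕ) (A : List Cell) : List Cell → List Cell → Set where
  move : ∀ {M B} (mv : List Cell) → ValidMove a (M ++ B) mv →
         ( ContainsCopy A (mv ++ M)
         ⊎ (∀ bm → ValidMove b (mv ++ M ++ B) bm → MakerWins a b A (mv ++ M) (bm ++ B)) ) →
         MakerWins a b A M B

Winner : ℕ → ℕ → List Cell → Set
Winner a b A = MakerWins a b A [] []

P31 : List Cell
P31 = (+ 0 , + 0) ∷ (+ 1 , + 0) ∷ (+ 2 , + 0) ∷ []

P32 : List Cell
P32 = (+ 0 , + 0) ∷ (+ 1 , + 0) ∷ (+ 0 , + 1) ∷ []

-- τ(A) = (1,7,∞): b_1 = 1, b_2 = 7, b_n = ∞ for n ≥ 3 (b_n = greatest b with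
-- A an (n,b)-winner).
open import Data.Nat using (_≥_)
open import Relation.Nullary using (¬_)

Tau1-7-∞ : List Cell → Set
Tau1-7-∞ A =
  Winner 1 1 A × (∀ b → b ≥ 2 → ¬ Winner 1 b A) ×
  Winner 2 7 A × (∀ b → b ≥ 8 → ¬ Winner 2 b A) ×
  (∀ n b → n ≥ 3 → Winner n b A)

-- Maker's wins.
--   * (n,b) with n ≥ 3: a polyomino with at most n cells is marked in the
--     first move (winInOneMove).
--   * (1,1): maker marks the origin, then a cell of a "fork" avoiding
--     breaker's cell, after which two distinct cells complete a copy
--     (forkWin).
--   * (2,7): maker's first two cells admit eight pairwise disjoint
--     completing pairs, and seven breaker cells cannot meet all of them
--     (hitting-bound, disjointCompletionsWin).
-- Breaker's wins all follow one scheme (breakerWins): fix a graph on the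
-- cells and answer every maker move by marking all graph neighbours of the
-- new cells, so that every neighbour of a maker cell is marked (Covered).
--   * (1,b) with b ≥ 2: if every copy of the tromino contains an edge of a
--     graph of degree ≤ 2, maker's cells stay independent (edgeBreaker);
--     we use horizontal adjacency for P₃,₂ and a domino tiling for P₃,₁.
--   * (2,b) with b ≥ 8: in the grid graph every copy has a cell adjacent to
--     the two others, and such a centre can never be created (centreBreaker).
module Submission where

open import Defs
open import Data.Bool using (true; false; if_then_else_)
open import Data.Empty using (⊥; ⊥-elim)
open import Data.Nat as ℕ using (ℕ; zero; suc; _≤_; _<_; z≤n; s≤s)
import Data.Nat.Properties as ℕₚ
open import Data.Integer as ℤ using (ℤ; +_; -[1+_]; _+_; -_; _-_; ∣_∣; 1ℤ)
import Data.Integer.Properties as ℤₚ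
open import Data.Product as Product using (∃-syntax; _×_; _,_; proj₁; proj₂)
open import Data.Product.Properties using (≡-dec)
open import Data.Sum as Sum using (_⊎_; inj₁; inj₂; [_,_])
open import Data.List using (List; []; _∷_; _++_; length; concatMap; cartesianProduct)
open import Data.List.Properties using (length-++; ++-identityʳ)
open import Data.List.Relation.Unary.All as All using (All; []; _∷_; all?)
open import Data.List.Relation.Unary.All.Properties using (¬Any⇒All¬)
open import Data.List.Relation.Unary.Any using (Any; here; there; any?)
open import Data.List.Relation.Unary.AllPairs using (AllPairs; []; _∷_; allPairs?)
open import Data.List.Membership.Propositional using (_∈_; _∉_; find; lose)
open import Data.List.Membership.Propositional.Properties using (∈-++⁺ˡ; ∈-++⁺ʳ; ∈-++⁻; ∈-concatMap⁺)
open import Relation.Binary using (DecidableEquality)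
open import Relation.Binary.PropositionalEquality using (_≡_; _≢_; refl; sym; trans; cong; cong₂; subst; module ≡-Reasoning)
open import Function using (_∘_)
open import Relation.Nullary using (¬_; Dec; yes; no)
open import Relation.Nullary.Decidable using (from-yes; ¬?; _×-dec_; _⊎-dec_; toWitness; toWitnessFalse; True; False; decidable-stable)
open import Relation.Unary using (Decidable)
open import Algebra.Properties.AbelianGroup ℤₚ.+-0-abelianGroup using (∙-cancelʳ)

_≟ᶜ_ : DecidableEquality Cell
_≟ᶜ_ = ≡-dec ℤ._≟_ ℤ._≟_

open import Data.List.Membership.DecPropositional _≟ᶜ_ using (_∈?_)
open import Data.List.Relation.Unary.Unique.DecPropositional _≟ᶜ_ using (unique?)

∉-++ : ∀ {x : Cell} xs {ys} → x ∉ xs → x ∉ ys → x ∉ xs ++ ys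
∉-++ xs x∉xs x∉ys = [ x∉xs , x∉ys ] ∘ ∈-++⁻ xs

Disjoint : {X : Set} → List X → List X → Set
Disjoint S T = All (_∉ T) S

regroup : ∀ mv M B bm {z : Cell} → z ∈ bm ++ mv ++ M ++ B → z ∈ (mv ++ M) ++ bm ++ B
regroup mv M B bm p with ∈-++⁻ bm p
... | inj₁ q = ∈-++⁺ʳ (mv ++ M) (∈-++⁺ˡ q)
... | inj₂ q with ∈-++⁻ mv q
...   | inj₁ r = ∈-++⁺ˡ (∈-++⁺ˡ r)
...   | inj₂ r with ∈-++⁻ M r
...     | inj₁ s = ∈-++⁺ˡ (∈-++⁺ʳ mv s)
...     | inj₂ s = ∈-++⁺ʳ (mv ++ M) (∈-++⁺ʳ bm s)

-- The sum of the absolute first coordinates bounds each of them; one more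
-- gives a cell outside the list, used by breaker to pad his moves.
width : List Cell → ℕ
width [] = 0
width ((x , _) ∷ X) = ∣ x ∣ ℕ.+ width X

width-bound : ∀ {x y} X → (x , y) ∈ X → ∣ x ∣ ≤ width X
width-bound (_ ∷ X) (here refl) = ℕₚ.m≤m+n _ (width X)
width-bound ((x′ , _) ∷ X) (there p) = ℕₚ.≤-trans (width-bound X p) (ℕₚ.m≤n+m (width X) ∣ x′ ∣)

fresh : List Cell → Cell
fresh X = (+ suc (width X) , + 0)

fresh∉ : ∀ X → fresh X ∉ X
fresh∉ X p = ℕₚ.<-irrefl refl (width-bound X p)

record Reply (k : ℕ) (X L : List Cell) : Set where
  field
    cells  : List Cell
    legal  : ValidMove k X cells
    covers : ∀ {l} → l ∈ L → l ∈ cells ++ X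

prepend : ∀ {k X L c} → c ∉ X → Reply k (c ∷ X) L → Reply (suc k) X (c ∷ L)
prepend {k} {X} {L} {c} c∉X record { cells = cs ; legal = len , uniq , avoid ; covers = cov } = record
  { cells  = c ∷ cs
  ; legal  = cong suc len
           , All.map (λ c′∉ c≡c′ → c′∉ (here (sym c≡c′))) avoid ∷ uniq
           , c∉X ∷ All.map (λ c′∉ c′∈ → c′∉ (there c′∈)) avoid
  ; covers = λ { (here l≡c) → here l≡c ; (there l∈L) → shift (cov l∈L) }
  }
  where
    shift : ∀ {l} → l ∈ cs ++ c ∷ X → l ∈ (c ∷ cs) ++ X
    shift p with ∈-++⁻ cs p
    ... | inj₁ q = there (∈-++⁺ˡ q)
    ... | inj₂ (here q) = here q
    ... | inj₂ (there q) = there (∈-++⁺ʳ cs q)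

-- Breaker can mark every unmarked cell of a list L with a move of any size
-- k ≥ |L|, padding with fresh cells.
reply : ∀ L k X → length L ≤ k → Reply k X L
reply [] zero X _ = record { cells = [] ; legal = refl , [] , [] ; covers = λ () }
reply [] (suc k) X _ = record { cells = cells ; legal = legal ; covers = λ () }
  where open Reply (prepend (fresh∉ X) (reply [] k (fresh X ∷ X) z≤n))
reply (l ∷ L) k X le with l ∈? X
... | yes l∈X = record { cells = cells ; legal = legal
                      ; covers = λ { (here refl) → ∈-++⁺ʳ cells l∈X ; (there q) → covers q } }
  where open Reply (reply L k X (ℕₚ.≤-trans (ℕₚ.n≤1+n _) le))
reply (l ∷ L) (suc k) X (s≤s le) | no l∉X = prepend l∉X (reply L k (l ∷ X) le)

infixl 6 _⊕_
_⊕_ : Cell → Cell → Cell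
(a , b) ⊕ (x , y) = (a + x , b + y)

origin : Cell
origin = (+ 0 , + 0)

identity : Orientation
identity = orient false false false

applyIso-identity : ∀ c → applyIso identity origin c ≡ c
applyIso-identity (x , y) = cong₂ _,_ (ℤₚ.+-identityʳ x) (ℤₚ.+-identityʳ y)

applyIso-translate : ∀ g t c → applyIso g t c ≡ applyIso g origin c ⊕ t
applyIso-translate (orient s nx ny) (tx , ty) (x , y) =
  cong₂ _,_ (cong (_+ tx) (sym (ℤₚ.+-identityʳ (if nx then - u else u))))
            (cong (_+ ty) (sym (ℤₚ.+-identityʳ (if ny then - v else v))))
  where
    u = if s then y else x
    v = if s then x else y

⊕-cancelʳ : ∀ {c d} t → c ⊕ t ≡ d ⊕ t → c ≡ d
⊕-cancelʳ (tx , ty) e =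
  cong₂ _,_ (∙-cancelʳ tx _ _ (cong proj₁ e)) (∙-cancelʳ ty _ _ (cong proj₂ e))

orientations : List Orientation
orientations =
  orient false false false ∷ orient false false true ∷ orient false true false ∷ orient false true true ∷
  orient true false false ∷ orient true false true ∷ orient true true false ∷ orient true true true ∷ []

every-orientation : ∀ g → g ∈ orientations
every-orientation (orient false false false) = here refl
every-orientation (orient false false true) = there (here refl)
every-orientation (orient false true false) = there (there (here refl))
every-orientation (orient false true true) = there (there (there (here refl)))
every-orientation (orient true false false) = there (there (there (there (here refl))))
every-orientation (orient true false true) = there (there (there (there (there (here refl)))))
every-orientation (orient true true false) = there (there (there (there (there (there (here refl))))))
every-orientation (orient true true true) = there (there (there (there (there (there (there (here refl)))))))

all-orientations : ∀ {P : Orientation → Set} (P? : Decidable P) → {True (all? P? orientations)} → ∀ g → P g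
all-orientations P? {ok} g = All.lookup (toWitness ok) (every-orientation g)

anchor : Orientation → Cell → List Cell → Cell
anchor g s [] = s
anchor g (sx , sy) (a ∷ _) = let (ax , ay) = applyIso g origin a in (sx - ax , sy - ay)

-- A decidable certificate of ContainsCopy A S: it suffices to try the
-- translations that send the first cell of A onto a cell of S.
AnchoredCopy : List Cell → List Cell → Set
AnchoredCopy A S =
  Any (λ (g , s) → All (λ c → applyIso g (anchor g s A) c ∈ S) A) (cartesianProduct orientations S)

anchoredCopy? : ∀ A S → Dec (AnchoredCopy A S)
anchoredCopy? A S = any? (λ (g , s) → all? (λ c → applyIso g (anchor g s A) c ∈? S) A) _

anchored⇒copy : ∀ {A S} → AnchoredCopy A S → ContainsCopy A S
anchored⇒copy {A} found = let ((g , s) , _ , placed) = find found in g , anchor g s A , placed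

Graph : Set
Graph = Cell → List Cell

Symmetric : Graph → Set
Symmetric G = ∀ {c d} → d ∈ G c → c ∈ G d

Irreflexive : Graph → Set
Irreflexive G = ∀ {c d} → d ∈ G c → d ≢ c

TranslationInvariant : Graph → Set
TranslationInvariant G = ∀ c {d} t → d ∈ G c → d ⊕ t ∈ G (c ⊕ t)

MaxDegree : Graph → ℕ → Set
MaxDegree G k = ∀ c → length (G c) ≤ k

neighbourhood-bound : ∀ {G k} → MaxDegree G k → ∀ xs → length (concatMap G xs) ≤ length xs ℕ.* k
neighbourhood-bound deg [] = z≤n
neighbourhood-bound {G} {k} deg (x ∷ xs) = begin
  length (G x ++ concatMap G xs)                 ≡⟨ length-++ (G x) ⟩
  length (G x) ℕ.+ length (concatMap G xs)       ≤⟨ ℕₚ.+-mono-≤ (deg x) (neighbourhood-bound deg xs) ⟩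
  k ℕ.+ length xs ℕ.* k                          ∎
  where open ℕₚ.≤-Reasoning

HasEdge : Graph → Cell → Cell → Cell → Set
HasEdge G p q r = q ∈ G p ⊎ r ∈ G p ⊎ r ∈ G q

Centre : Graph → Cell → Cell → Cell → Set
Centre G p q r = q ∈ G p × r ∈ G p × q ≢ r

HasCentre : Graph → Cell → Cell → Cell → Set
HasCentre G p q r = Centre G p q r ⊎ Centre G q p r ⊎ Centre G r p q

hasEdge? : ∀ G p q r → Dec (HasEdge G p q r)
hasEdge? G p q r = (q ∈? G p) ⊎-dec ((r ∈? G p) ⊎-dec (r ∈? G q))

hasCentre? : ∀ G p q r → Dec (HasCentre G p q r)
hasCentre? G p q r = centre? p q r ⊎-dec (centre? q p r ⊎-dec centre? r p q)
  where
    centre? : ∀ p q r → Dec (Centre G p q r)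
    centre? p q r = (q ∈? G p) ×-dec ((r ∈? G p) ×-dec ¬? (q ≟ᶜ r))

hasEdge-⊕ : ∀ G → TranslationInvariant G → ∀ {p q r} t → HasEdge G p q r → HasEdge G (p ⊕ t) (q ⊕ t) (r ⊕ t)
hasEdge-⊕ G inv {p} {q} t = Sum.map (inv p t) (Sum.map (inv p t) (inv q t))

hasCentre-⊕ : ∀ G → TranslationInvariant G → ∀ {p q r} t → HasCentre G p q r → HasCentre G (p ⊕ t) (q ⊕ t) (r ⊕ t)
hasCentre-⊕ G inv t = Sum.map centre-⊕ (Sum.map centre-⊕ centre-⊕)
  where
    centre-⊕ : ∀ {p q r} → Centre G p q r → Centre G (p ⊕ t) (q ⊕ t) (r ⊕ t)
    centre-⊕ {p} (q∼p , r∼p , q≢r) = inv p t q∼p , inv p t r∼p , q≢r ∘ ⊕-cancelʳ t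

EveryCopy : (Cell → Cell → Cell → Set) → Cell → Cell → Cell → Set
EveryCopy P a0 a1 a2 = ∀ g t → P (applyIso g t a0) (applyIso g t a1) (applyIso g t a2)

everyCopy-by-translation : ∀ {P : Cell → Cell → Cell → Set} {a0 a1 a2} →
  (∀ {p q r} t → P p q r → P (p ⊕ t) (q ⊕ t) (r ⊕ t)) →
  (∀ g → P (applyIso g origin a0) (applyIso g origin a1) (applyIso g origin a2)) →
  EveryCopy P a0 a1 a2
everyCopy-by-translation {a0 = a0} {a1} {a2} shift atOrigin g t
  rewrite applyIso-translate g t a0 | applyIso-translate g t a1 | applyIso-translate g t a2 =
  shift t (atOrigin g)

winInOneMove : ∀ {n b} A → length A ≤ n → Winner n b A
winInOneMove {n} A |A|≤n = move cells legal (inj₁ (identity , origin , All.tabulate placed))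
  where
    open Reply (reply A n [] |A|≤n)
    placed : ∀ {c} → c ∈ A → applyIso identity origin c ∈ cells ++ []
    placed {c} c∈A = subst (_∈ cells ++ []) (sym (applyIso-identity c)) (covers c∈A)

singleMove : ∀ {X c} → c ∉ X → ValidMove 1 X (c ∷ [])
singleMove c∉X = refl , [] ∷ [] , c∉X ∷ []

-- Maker's (1,1) plan after marking the origin: a cell c, and two distinct
-- cells e₁, e₂ each completing a copy of A with the origin and c.
record Fork (A : List Cell) : Set where
  field
    c e₁ e₂  : Cell
    c≢origin : c ≢ origin
    e₁-new   : e₁ ∉ c ∷ origin ∷ []
    e₂-new   : e₂ ∉ c ∷ origin ∷ []
    e₁≢e₂    : e₁ ≢ e₂
    copy₁    : ContainsCopy A (e₁ ∷ c ∷ origin ∷ [])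
    copy₂    : ContainsCopy A (e₂ ∷ c ∷ origin ∷ [])

  cells : List Cell
  cells = c ∷ e₁ ∷ e₂ ∷ []

fork : ∀ A c e₁ e₂ → {False (c ≟ᶜ origin)} →
       {False (e₁ ∈? c ∷ origin ∷ [])} → {False (e₂ ∈? c ∷ origin ∷ [])} → {False (e₁ ≟ᶜ e₂)} →
       {True (anchoredCopy? A (e₁ ∷ c ∷ origin ∷ []))} → {True (anchoredCopy? A (e₂ ∷ c ∷ origin ∷ []))} →
       Fork A
fork A c e₁ e₂ {c≢o} {e₁-new} {e₂-new} {e₁≢e₂} {copy₁} {copy₂} = record
  { c = c ; e₁ = e₁ ; e₂ = e₂
  ; c≢origin = toWitnessFalse c≢o
  ; e₁-new = toWitnessFalse e₁-new ; e₂-new = toWitnessFalse e₂-new ; e₁≢e₂ = toWitnessFalse e₁≢e₂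
  ; copy₁ = anchored⇒copy (toWitness copy₁) ; copy₂ = anchored⇒copy (toWitness copy₂)
  }

-- With maker on the origin and breaker on a cell outside a fork, maker marks
-- c; breaker can take only one of e₁, e₂, and maker takes the other.
playFork : ∀ {A} (F : Fork A) {x} → x ∉ Fork.cells F → MakerWins 1 1 A (origin ∷ []) (x ∷ [])
playFork {A} F {x} x∉F = move (c ∷ []) (singleMove c-new) (inj₂ λ
  { [] (() , _)
  ; (y ∷ []) _ → finish y
  ; (_ ∷ _ ∷ _) (() , _) })
  where
    open Fork F
    avoids-x : ∀ {z} → z ∈ cells → z ∉ x ∷ []
    avoids-x z∈F (here z≡x) = x∉F (subst (_∈ cells) z≡x z∈F)

    c-new : c ∉ origin ∷ x ∷ []
    c-new = ∉-++ (origin ∷ []) (λ { (here c≡o) → c≢origin c≡o }) (avoids-x (here refl))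

    complete : ∀ {e y} → e ∈ cells → e ∉ c ∷ origin ∷ [] → e ≢ y →
               ContainsCopy A (e ∷ c ∷ origin ∷ []) → MakerWins 1 1 A (c ∷ origin ∷ []) (y ∷ x ∷ [])
    complete e∈F e-new e≢y copy =
      move (_ ∷ []) (singleMove (∉-++ (c ∷ origin ∷ []) e-new (∉-++ (_ ∷ []) (λ { (here e≡y) → e≢y e≡y }) (avoids-x e∈F))))
           (inj₁ copy)

    finish : ∀ y → MakerWins 1 1 A (c ∷ origin ∷ []) (y ∷ x ∷ [])
    finish y with e₁ ≟ᶜ y
    ... | no e₁≢y = complete (there (here refl)) e₁-new e₁≢y copy₁
    ... | yes e₁≡y = complete (there (there (here refl))) e₂-new (λ e₂≡y → e₁≢e₂ (trans e₁≡y (sym e₂≡y))) copy₂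

-- Two disjoint forks: breaker's first cell misses one of them.
forkWin : ∀ {A} (F₁ F₂ : Fork A) → Disjoint (Fork.cells F₁) (Fork.cells F₂) → Winner 1 1 A
forkWin {A} F₁ F₂ F₁#F₂ = move (origin ∷ []) (singleMove (λ ())) (inj₂ λ
  { [] (() , _)
  ; (x ∷ []) _ → respond x
  ; (_ ∷ _ ∷ _) (() , _) })
  where
    respond : ∀ x → MakerWins 1 1 A (origin ∷ []) (x ∷ [])
    respond x with x ∈? Fork.cells F₁
    ... | no x∉F₁ = playFork F₁ x∉F₁
    ... | yes x∈F₁ = playFork F₂ (All.lookup F₁#F₂ x∈F₁)

module _ {X : Set} where

  remove : ∀ {x : X} xs → x ∈ xs → List X
  remove (_ ∷ xs) (here _) = xs
  remove (y ∷ xs) (there p) = y ∷ remove xs p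

  remove-length : ∀ {x : X} xs (p : x ∈ xs) → length xs ≡ suc (length (remove xs p))
  remove-length (_ ∷ xs) (here _) = refl
  remove-length (y ∷ xs) (there p) = cong suc (remove-length xs p)

  remove-keeps : ∀ {x y : X} xs (p : x ∈ xs) → y ∈ xs → y ≢ x → y ∈ remove xs p
  remove-keeps (_ ∷ xs) (here refl) (here refl) y≢x = ⊥-elim (y≢x refl)
  remove-keeps (_ ∷ xs) (here refl) (there q) y≢x = q
  remove-keeps (_ ∷ xs) (there p) (here refl) y≢x = here refl
  remove-keeps (_ ∷ xs) (there p) (there q) y≢x = there (remove-keeps xs p q y≢x)

  -- Pairwise disjoint lists that all meet B number at most |B|: each of
  -- them uses up its own element of B.
  hitting-bound : ∀ Ss B → AllPairs Disjoint Ss → All (λ S → Any (_∈ B) S) Ss → length Ss ≤ length B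
  hitting-bound [] B _ _ = z≤n
  hitting-bound (S ∷ Ss) B (S#Ss ∷ disjoint) (S∩B ∷ meets) with find S∩B
  ... | z , z∈S , z∈B = begin
    suc (length Ss)              ≤⟨ s≤s (hitting-bound Ss (remove B z∈B) disjoint (All.zipWith stillMeets (S#Ss , meets))) ⟩
    suc (length (remove B z∈B))  ≡⟨ sym (remove-length B z∈B) ⟩
    length B                     ∎
    where
      open ℕₚ.≤-Reasoning
      stillMeets : ∀ {T} → Disjoint S T × Any (_∈ B) T → Any (_∈ remove B z∈B) T
      stillMeets {T} (S#T , T∩B) with find T∩B
      ... | y , y∈T , y∈B = lose y∈T (remove-keeps B z∈B y∈B (λ y≡z → All.lookup S#T z∈S (subst (_∈ T) y≡z y∈T)))

avoidOrMeetAll : ∀ (Ss : List (List Cell)) B →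
  (∃[ S ] S ∈ Ss × Disjoint S B) ⊎ All (λ S → Any (_∈ B) S) Ss
avoidOrMeetAll Ss B with any? (λ S → ¬? (any? (_∈? B) S)) Ss
... | yes found = let (S , S∈Ss , S∩B≡∅) = find found in inj₁ (S , S∈Ss , ¬Any⇒All¬ S S∩B≡∅)
... | no none = inj₂ (All.map (λ {S} → decidable-stable (any? (_∈? B) S)) (¬Any⇒All¬ Ss none))

validMove-++ : ∀ {a M B S} → ValidMove a M S → Disjoint S B → ValidMove a (M ++ B) S
validMove-++ {M = M} (len , uniq , avoidM) avoidB = len , uniq , All.zipWith (λ (m , b) → ∉-++ M m b) (avoidM , avoidB)

Completion : ℕ → List Cell → List Cell → List Cell → Set
Completion a A M S = ValidMove a M S × ContainsCopy A (S ++ M)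

disjoint? : ∀ (S T : List Cell) → Dec (Disjoint S T)
disjoint? S T = all? (λ z → ¬? (z ∈? T)) S

validMove? : ∀ a X S → Dec (ValidMove a X S)
validMove? a X S = (length S ℕ.≟ a) ×-dec (unique? S ×-dec disjoint? S X)

completions : ∀ a A M Ss →
  {True (all? (λ S → validMove? a M S ×-dec anchoredCopy? A (S ++ M)) Ss)} →
  All (Completion a A M) Ss
completions a A M Ss {ok} = All.map (Product.map₂ anchored⇒copy) (toWitness ok)

-- If maker's first move M admits more than b pairwise disjoint completions,
-- breaker's b cells miss one of them.
disjointCompletionsWin : ∀ {a b A} M → ValidMove a [] M → ∀ Ss →
  All (Completion a A M) Ss → AllPairs Disjoint Ss → b < length Ss → Winner a b A
disjointCompletionsWin {a} {b} {A} M firstMove Ss complete disjoint b<|Ss| = move M firstMove (inj₂ respond)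
  where
    respond : ∀ bm → ValidMove b (M ++ []) bm → MakerWins a b A (M ++ []) (bm ++ [])
    respond bm (|bm|≡b , _) rewrite ++-identityʳ M with avoidOrMeetAll Ss (bm ++ [])
    ... | inj₁ (S , S∈Ss , S#bm) = let (legal , copy) = All.lookup complete S∈Ss in
      move S (validMove-++ legal S#bm) (inj₁ copy)
    ... | inj₂ allMeet = ⊥-elim (ℕₚ.<⇒≱ b<|Ss| (begin
      length Ss         ≤⟨ hitting-bound Ss (bm ++ []) disjoint allMeet ⟩
      length (bm ++ []) ≡⟨ cong length (++-identityʳ bm) ⟩
      length bm         ≡⟨ |bm|≡b ⟩
      b                 ∎))
      where open ℕₚ.≤-Reasoning

breakerWins : ∀ {a b A} (I : List Cell → List Cell → Set) →
  (∀ {M B mv} → I M B → ValidMove a (M ++ B) mv → ¬ ContainsCopy A (mv ++ M)) →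
  (∀ {M B mv} → I M B → ValidMove a (M ++ B) mv → ∃[ bm ] ValidMove b (mv ++ M ++ B) bm × I (mv ++ M) (bm ++ B)) →
  ∀ {M B} → I M B → ¬ MakerWins a b A M B
breakerWins I safe restore inv (move mv legal (inj₁ copy)) = safe inv legal copy
breakerWins I safe restore inv (move mv legal (inj₂ next)) with restore inv legal
... | bm , bm-legal , inv′ = breakerWins I safe restore inv′ (next bm bm-legal)

Covered : Graph → List Cell → List Cell → Set
Covered G M B = ∀ {c d} → c ∈ M → d ∈ G c → d ∈ M ++ B

-- Marking all neighbours of maker's a new cells, at most a·k ≤ b of them,
-- keeps the position covered.
coverNeighbours : ∀ {G k a b M B mv} → MaxDegree G k → a ℕ.* k ≤ b → Covered G M B →
  ValidMove a (M ++ B) mv → ∃[ bm ] ValidMove b (mv ++ M ++ B) bm × Covered G (mv ++ M) (bm ++ B)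
coverNeighbours {G} {k} {a} {b} {M} {B} {mv} deg ak≤b covered (|mv|≡a , _) = cells , legal , covered′
  where
    bound : length (concatMap G mv) ≤ b
    bound = ℕₚ.≤-trans (neighbourhood-bound deg mv) (subst (λ n → n ℕ.* k ≤ b) (sym |mv|≡a) ak≤b)

    open Reply (reply (concatMap G mv) b (mv ++ M ++ B) bound)

    covered′ : Covered G (mv ++ M) (cells ++ B)
    covered′ c∈ d∼c with ∈-++⁻ mv c∈
    ... | inj₁ c∈mv = regroup mv M B cells (covers (∈-concatMap⁺ G (lose c∈mv d∼c)))
    ... | inj₂ c∈M = regroup mv M B cells (∈-++⁺ʳ cells (∈-++⁺ʳ mv (covered c∈M d∼c)))

Independent : Graph → List Cell → Set
Independent G M = ∀ {c d} → c ∈ M → d ∈ G c → d ∉ M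

-- An unmarked cell of a covered position has no maker neighbour, so it
-- keeps maker's cells independent.
independent-∷ : ∀ {G M B c} → Symmetric G → Irreflexive G → Covered G M B → Independent G M →
  c ∉ M ++ B → Independent G (c ∷ M)
independent-∷ symm irr cov ind c-new (here refl) d∼c (here d≡c) = irr d∼c d≡c
independent-∷ symm irr cov ind c-new (here refl) d∼c (there d∈M) = c-new (cov d∈M (symm d∼c))
independent-∷ symm irr cov ind c-new (there c′∈M) d∼c′ (here refl) = c-new (cov c′∈M d∼c′)
independent-∷ symm irr cov ind c-new (there c′∈M) d∼c′ (there d∈M) = ind c′∈M d∼c′ d∈M

independent-no-copy : ∀ {G a0 a1 a2 S} → EveryCopy (HasEdge G) a0 a1 a2 → Independent G S →
  ¬ ContainsCopy (a0 ∷ a1 ∷ a2 ∷ []) S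
independent-no-copy edge ind (g , t , p0 ∷ p1 ∷ p2 ∷ []) with edge g t
... | inj₁ p1∼p0 = ind p0 p1∼p0 p1
... | inj₂ (inj₁ p2∼p0) = ind p0 p2∼p0 p2
... | inj₂ (inj₂ p2∼p1) = ind p1 p2∼p1 p2

edgeBreaker : ∀ G {k a0 a1 a2} → Symmetric G → Irreflexive G → MaxDegree G k →
  EveryCopy (HasEdge G) a0 a1 a2 → ∀ b → k ≤ b → ¬ Winner 1 b (a0 ∷ a1 ∷ a2 ∷ [])
edgeBreaker G {k} {a0} {a1} {a2} symm irr deg edge b k≤b = breakerWins Inv safe restore ((λ ()) , (λ ()))
  where
    A : List Cell
    A = a0 ∷ a1 ∷ a2 ∷ []

    Inv : List Cell → List Cell → Set
    Inv M B = Covered G M B × Independent G M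

    extend : ∀ {M B mv} → Inv M B → ValidMove 1 (M ++ B) mv → Independent G (mv ++ M)
    extend {mv = []} _ (() , _)
    extend {mv = _ ∷ _ ∷ _} _ (() , _)
    extend {mv = _ ∷ []} (cov , ind) (_ , _ , c-new ∷ []) = independent-∷ symm irr cov ind c-new

    safe : ∀ {M B mv} → Inv M B → ValidMove 1 (M ++ B) mv → ¬ ContainsCopy A (mv ++ M)
    safe inv legal = independent-no-copy edge (extend inv legal)

    restore : ∀ {M B mv} → Inv M B → ValidMove 1 (M ++ B) mv →
              ∃[ bm ] ValidMove b (mv ++ M ++ B) bm × Inv (mv ++ M) (bm ++ B)
    restore inv legal with coverNeighbours deg (subst (_≤ b) (sym (ℕₚ.*-identityˡ k)) k≤b) (proj₁ inv) legal
    ... | bm , bm-legal , cov′ = bm , bm-legal , cov′ , extend inv legal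

no-three-among-two : ∀ {p q r c₁ c₂ : Cell} → p ≡ c₁ ⊎ p ≡ c₂ → q ≡ c₁ ⊎ q ≡ c₂ → r ≡ c₁ ⊎ r ≡ c₂ →
  q ≢ p → r ≢ p → q ≢ r → ⊥
no-three-among-two (inj₁ p≡) (inj₁ q≡) _ q≢p _ _ = q≢p (trans q≡ (sym p≡))
no-three-among-two (inj₂ p≡) (inj₂ q≡) _ q≢p _ _ = q≢p (trans q≡ (sym p≡))
no-three-among-two (inj₁ p≡) _ (inj₁ r≡) _ r≢p _ = r≢p (trans r≡ (sym p≡))
no-three-among-two (inj₂ p≡) _ (inj₂ r≡) _ r≢p _ = r≢p (trans r≡ (sym p≡))
no-three-among-two (inj₁ _) (inj₂ q≡) (inj₂ r≡) _ _ q≢r = q≢r (trans q≡ (sym r≡))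
no-three-among-two (inj₂ _) (inj₁ q≡) (inj₁ r≡) _ _ q≢r = q≢r (trans q≡ (sym r≡))

module FreshPair {G : Graph} {M B : List Cell} {c₁ c₂ : Cell} (symm : Symmetric G) (irr : Irreflexive G)
                 (cov : Covered G M B) (c₁-new : c₁ ∉ M ++ B) (c₂-new : c₂ ∉ M ++ B) where

  -- The neighbours of an old cell are marked, hence not new.
  old-neighbour : ∀ {p z} → p ∈ M → z ∈ G p → z ∈ c₁ ∷ c₂ ∷ M → z ∈ M
  old-neighbour p∈M z∼p (here z≡c₁) = ⊥-elim (c₁-new (subst (_∈ M ++ B) z≡c₁ (cov p∈M z∼p)))
  old-neighbour p∈M z∼p (there (here z≡c₂)) = ⊥-elim (c₂-new (subst (_∈ M ++ B) z≡c₂ (cov p∈M z∼p)))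
  old-neighbour p∈M z∼p (there (there z∈M)) = z∈M

  -- An unmarked cell has no old neighbour.
  new-neighbour : ∀ {p z} → p ∉ M ++ B → z ∈ G p → z ∈ c₁ ∷ c₂ ∷ M → z ≡ c₁ ⊎ z ≡ c₂
  new-neighbour p-new z∼p (here z≡c₁) = inj₁ z≡c₁
  new-neighbour p-new z∼p (there (here z≡c₂)) = inj₂ z≡c₂
  new-neighbour p-new z∼p (there (there z∈M)) = ⊥-elim (p-new (cov z∈M (symm z∼p)))

  -- A new cell cannot be a centre: its neighbours would be two distinct
  -- new cells other than itself.
  new-centre : ∀ {p q r} → p ∉ M ++ B → p ≡ c₁ ⊎ p ≡ c₂ → Centre G p q r →
               q ∈ c₁ ∷ c₂ ∷ M → r ∈ c₁ ∷ c₂ ∷ M → ⊥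
  new-centre p-new p-among (q∼p , r∼p , q≢r) q∈ r∈ =
    no-three-among-two p-among (new-neighbour p-new q∼p q∈) (new-neighbour p-new r∼p r∈) (irr q∼p) (irr r∼p) q≢r

  centre-old : ∀ {p q r} → Centre G p q r → p ∈ c₁ ∷ c₂ ∷ M → q ∈ c₁ ∷ c₂ ∷ M → r ∈ c₁ ∷ c₂ ∷ M →
               p ∈ M × q ∈ M × r ∈ M
  centre-old (q∼p , r∼p , _) (there (there p∈M)) q∈ r∈ = p∈M , old-neighbour p∈M q∼p q∈ , old-neighbour p∈M r∼p r∈
  centre-old centre (here refl) q∈ r∈ = ⊥-elim (new-centre c₁-new (inj₁ refl) centre q∈ r∈)
  centre-old centre (there (here refl)) q∈ r∈ = ⊥-elim (new-centre c₂-new (inj₂ refl) centre q∈ r∈)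

  copy-old : ∀ {a0 a1 a2} → EveryCopy (HasCentre G) a0 a1 a2 →
             ContainsCopy (a0 ∷ a1 ∷ a2 ∷ []) (c₁ ∷ c₂ ∷ M) → ContainsCopy (a0 ∷ a1 ∷ a2 ∷ []) M
  copy-old centre (g , t , p0 ∷ p1 ∷ p2 ∷ []) with centre g t
  ... | inj₁ c = let (m0 , m1 , m2) = centre-old c p0 p1 p2 in g , t , m0 ∷ m1 ∷ m2 ∷ []
  ... | inj₂ (inj₁ c) = let (m1 , m0 , m2) = centre-old c p1 p0 p2 in g , t , m0 ∷ m1 ∷ m2 ∷ []
  ... | inj₂ (inj₂ c) = let (m2 , m0 , m1) = centre-old c p2 p0 p1 in g , t , m0 ∷ m1 ∷ m2 ∷ []

centreBreaker : ∀ G {k a0 a1 a2} → Symmetric G → Irreflexive G → MaxDegree G k →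
  EveryCopy (HasCentre G) a0 a1 a2 → ∀ b → 2 ℕ.* k ≤ b → ¬ Winner 2 b (a0 ∷ a1 ∷ a2 ∷ [])
centreBreaker G {k} {a0} {a1} {a2} symm irr deg centre b 2k≤b =
  breakerWins Inv safe restore ((λ ()) , λ { (_ , _ , () ∷ _) })
  where
    A : List Cell
    A = a0 ∷ a1 ∷ a2 ∷ []

    Inv : List Cell → List Cell → Set
    Inv M B = Covered G M B × ¬ ContainsCopy A M

    safe : ∀ {M B mv} → Inv M B → ValidMove 2 (M ++ B) mv → ¬ ContainsCopy A (mv ++ M)
    safe {mv = []} _ (() , _)
    safe {mv = _ ∷ []} _ (() , _)
    safe {mv = _ ∷ _ ∷ _ ∷ _} _ (() , _)
    safe {mv = _ ∷ _ ∷ []} (cov , noCopy) (_ , _ , c₁-new ∷ c₂-new ∷ []) =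
      noCopy ∘ FreshPair.copy-old symm irr cov c₁-new c₂-new centre

    restore : ∀ {M B mv} → Inv M B → ValidMove 2 (M ++ B) mv →
              ∃[ bm ] ValidMove b (mv ++ M ++ B) bm × Inv (mv ++ M) (bm ++ B)
    restore inv legal with coverNeighbours deg 2k≤b (proj₁ inv) legal
    ... | bm , bm-legal , cov′ = bm , bm-legal , cov′ , safe inv legal

suc≢ : ∀ x → ℤ.suc x ≢ x
suc≢ x e = ℤₚ.i≢suc[i] (sym e)

pred≢ : ∀ x → ℤ.pred x ≢ x
pred≢ x e = ℤₚ.i≢suc[i] (trans (sym (ℤₚ.suc-pred x)) (cong ℤ.suc e))

suc-+ : ∀ x t → ℤ.suc x + t ≡ ℤ.suc (x + t)
suc-+ = ℤₚ.+-assoc 1ℤ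

pred-+ : ∀ x t → ℤ.pred x + t ≡ ℤ.pred (x + t)
pred-+ = ℤₚ.+-assoc (- 1ℤ)

grid : Graph
grid (x , y) = (ℤ.suc x , y) ∷ (ℤ.pred x , y) ∷ (x , ℤ.suc y) ∷ (x , ℤ.pred y) ∷ []

grid-symmetric : Symmetric grid
grid-symmetric {x , y} (here refl) = there (here (cong₂ _,_ (sym (ℤₚ.pred-suc x)) refl))
grid-symmetric {x , y} (there (here refl)) = here (cong₂ _,_ (sym (ℤₚ.suc-pred x)) refl)
grid-symmetric {x , y} (there (there (here refl))) = there (there (there (here (cong₂ _,_ refl (sym (ℤₚ.pred-suc y))))))
grid-symmetric {x , y} (there (there (there (here refl)))) = there (there (here (cong₂ _,_ refl (sym (ℤₚ.suc-pred y)))))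

grid-irreflexive : Irreflexive grid
grid-irreflexive {x , y} (here refl) = suc≢ x ∘ cong proj₁
grid-irreflexive {x , y} (there (here refl)) = pred≢ x ∘ cong proj₁
grid-irreflexive {x , y} (there (there (here refl))) = suc≢ y ∘ cong proj₂
grid-irreflexive {x , y} (there (there (there (here refl)))) = pred≢ y ∘ cong proj₂

grid-invariant : TranslationInvariant grid
grid-invariant (x , y) (tx , ty) (here refl) = here (cong₂ _,_ (suc-+ x tx) refl)
grid-invariant (x , y) (tx , ty) (there (here refl)) = there (here (cong₂ _,_ (pred-+ x tx) refl))
grid-invariant (x , y) (tx , ty) (there (there (here refl))) = there (there (here (cong₂ _,_ refl (suc-+ y ty))))
grid-invariant (x , y) (tx , ty) (there (there (there (here refl)))) = there (there (there (here (cong₂ _,_ refl (pred-+ y ty)))))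

grid-degree : MaxDegree grid 4
grid-degree _ = ℕₚ.≤-refl

horizontal : Graph
horizontal (x , y) = (ℤ.suc x , y) ∷ (ℤ.pred x , y) ∷ []

horizontal-symmetric : Symmetric horizontal
horizontal-symmetric {x , y} (here refl) = there (here (cong₂ _,_ (sym (ℤₚ.pred-suc x)) refl))
horizontal-symmetric {x , y} (there (here refl)) = here (cong₂ _,_ (sym (ℤₚ.suc-pred x)) refl)

horizontal-irreflexive : Irreflexive horizontal
horizontal-irreflexive {x , y} (here refl) = suc≢ x ∘ cong proj₁
horizontal-irreflexive {x , y} (there (here refl)) = pred≢ x ∘ cong proj₁

horizontal-invariant : TranslationInvariant horizontal
horizontal-invariant (x , y) (tx , ty) (here refl) = here (cong₂ _,_ (suc-+ x tx) refl)
horizontal-invariant (x , y) (tx , ty) (there (here refl)) = there (here (cong₂ _,_ (pred-+ x tx) refl))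

horizontal-degree : MaxDegree horizontal 2
horizontal-degree _ = ℕₚ.≤-refl

-- ℕ is tiled by the dominoes {2k, 2k+1}; pairUp swaps the two halves.
pairUp : ℕ → ℕ
pairUp zero = 1
pairUp (suc zero) = 0
pairUp (suc (suc n)) = suc (suc (pairUp n))

pairUp-involutive : ∀ n → pairUp (pairUp n) ≡ n
pairUp-involutive zero = refl
pairUp-involutive (suc zero) = refl
pairUp-involutive (suc (suc n)) = cong (suc ∘ suc) (pairUp-involutive n)

pairUp-moves : ∀ n → pairUp n ≢ n
pairUp-moves zero ()
pairUp-moves (suc zero) ()
pairUp-moves (suc (suc n)) e = pairUp-moves n (ℕₚ.suc-injective (ℕₚ.suc-injective e))

-- Of two consecutive pairs among n, n+1, n+2 one is a domino.
pairUp-ascending : ∀ n → pairUp n ≡ suc n ⊎ pairUp (suc n) ≡ suc (suc n)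
pairUp-ascending zero = inj₁ refl
pairUp-ascending (suc zero) = inj₂ refl
pairUp-ascending (suc (suc n)) = Sum.map (cong (suc ∘ suc)) (cong (suc ∘ suc)) (pairUp-ascending n)

pairUp-descending : ∀ n → pairUp (suc n) ≡ n ⊎ pairUp (suc (suc n)) ≡ suc n
pairUp-descending n = Sum.map (swapped n) (swapped (suc n)) (pairUp-ascending n)
  where
    swapped : ∀ m {m′} → pairUp m ≡ m′ → pairUp m′ ≡ m
    swapped m e = trans (cong pairUp (sym e)) (pairUp-involutive m)

-- The domino tiling of ℤ by {2k, 2k+1}, mirrored onto the negative integers.
partner : ℤ → ℤ
partner (+ n) = + pairUp n
partner -[1+ n ] = -[1+ pairUp n ]

partner-involutive : ∀ i → partner (partner i) ≡ i
partner-involutive (+ n) = cong (+_) (pairUp-involutive n)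
partner-involutive -[1+ n ] = cong -[1+_] (pairUp-involutive n)

partner-moves : ∀ i → partner i ≢ i
partner-moves (+ n) e = pairUp-moves n (ℤₚ.+-injective e)
partner-moves -[1+ n ] e = pairUp-moves n (ℤₚ.-[1+-injective e)

partner-consecutive : ∀ i → partner i ≡ ℤ.suc i ⊎ partner (ℤ.suc i) ≡ ℤ.suc (ℤ.suc i)
partner-consecutive (+ n) = Sum.map (cong (+_)) (cong (+_)) (pairUp-ascending n)
partner-consecutive -[1+ zero ] = inj₂ refl
partner-consecutive -[1+ suc zero ] = inj₁ refl
partner-consecutive -[1+ suc (suc m) ] = Sum.swap (Sum.map (cong -[1+_]) (cong -[1+_]) (pairUp-descending m))

partner-among : ∀ k t → partner (k + t) ≡ ℤ.suc k + t ⊎ partner (ℤ.suc k + t) ≡ ℤ.suc (ℤ.suc k) + t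
partner-among k t = Sum.map (λ e → trans e (sym (suc-+ k t))) shifted (partner-consecutive (k + t))
  where
    shifted : partner (ℤ.suc (k + t)) ≡ ℤ.suc (ℤ.suc (k + t)) → partner (ℤ.suc k + t) ≡ ℤ.suc (ℤ.suc k) + t
    shifted e = begin
      partner (ℤ.suc k + t)       ≡⟨ cong partner (suc-+ k t) ⟩
      partner (ℤ.suc (k + t))     ≡⟨ e ⟩
      ℤ.suc (ℤ.suc (k + t))       ≡⟨ cong ℤ.suc (suc-+ k t) ⟨
      ℤ.suc (ℤ.suc k + t)         ≡⟨ suc-+ (ℤ.suc k) t ⟨
      ℤ.suc (ℤ.suc k) + t         ∎
      where open ≡-Reasoning

-- Each cell is joined to its partners in the horizontal and the vertical
-- domino tilings.
dominoes : Graph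
dominoes (x , y) = (partner x , y) ∷ (x , partner y) ∷ []

dominoes-symmetric : Symmetric dominoes
dominoes-symmetric {x , y} (here refl) = here (cong₂ _,_ (sym (partner-involutive x)) refl)
dominoes-symmetric {x , y} (there (here refl)) = there (here (cong₂ _,_ refl (sym (partner-involutive y))))

dominoes-irreflexive : Irreflexive dominoes
dominoes-irreflexive {x , y} (here refl) = partner-moves x ∘ cong proj₁
dominoes-irreflexive {x , y} (there (here refl)) = partner-moves y ∘ cong proj₂

dominoes-degree : MaxDegree dominoes 2
dominoes-degree _ = ℕₚ.≤-refl

everyCopyHasEdge : ∀ G → TranslationInvariant G → ∀ a0 a1 a2 →
  {True (all? (λ g → hasEdge? G (applyIso g origin a0) (applyIso g origin a1) (applyIso g origin a2)) orientations)} →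
  EveryCopy (HasEdge G) a0 a1 a2
everyCopyHasEdge G inv a0 a1 a2 {ok} = everyCopy-by-translation {P = HasEdge G} {a0} {a1} {a2} (hasEdge-⊕ G inv)
  (all-orientations (λ g → hasEdge? G (applyIso g origin a0) (applyIso g origin a1) (applyIso g origin a2)) {ok})

everyCopyHasCentre : ∀ G → TranslationInvariant G → ∀ a0 a1 a2 →
  {True (all? (λ g → hasCentre? G (applyIso g origin a0) (applyIso g origin a1) (applyIso g origin a2)) orientations)} →
  EveryCopy (HasCentre G) a0 a1 a2
everyCopyHasCentre G inv a0 a1 a2 {ok} = everyCopy-by-translation {P = HasCentre G} {a0} {a1} {a2} (hasCentre-⊕ G inv)
  (all-orientations (λ g → hasCentre? G (applyIso g origin a0) (applyIso g origin a1) (applyIso g origin a2)) {ok})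

row-ascending : ∀ tx y → HasEdge dominoes (+ 0 + tx , y) (+ 1 + tx , y) (+ 2 + tx , y)
row-ascending tx y with partner-among (+ 0) tx
... | inj₁ e = inj₁ (here (cong₂ _,_ (sym e) refl))
... | inj₂ e = inj₂ (inj₂ (here (cong₂ _,_ (sym e) refl)))

row-descending : ∀ tx y → HasEdge dominoes (+ 0 + tx , y) (-[1+ 0 ] + tx , y) (-[1+ 1 ] + tx , y)
row-descending tx y with partner-among -[1+ 1 ] tx
... | inj₁ e = inj₂ (inj₂ (dominoes-symmetric (here (cong₂ _,_ (sym e) refl))))
... | inj₂ e = inj₁ (dominoes-symmetric (here (cong₂ _,_ (sym e) refl)))

column-ascending : ∀ x ty → HasEdge dominoes (x , + 0 + ty) (x , + 1 + ty) (x , + 2 + ty)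
column-ascending x ty with partner-among (+ 0) ty
... | inj₁ e = inj₁ (there (here (cong₂ _,_ refl (sym e))))
... | inj₂ e = inj₂ (inj₂ (there (here (cong₂ _,_ refl (sym e)))))

column-descending : ∀ x ty → HasEdge dominoes (x , + 0 + ty) (x , -[1+ 0 ] + ty) (x , -[1+ 1 ] + ty)
column-descending x ty with partner-among -[1+ 1 ] ty
... | inj₁ e = inj₂ (inj₂ (dominoes-symmetric (there (here (cong₂ _,_ refl (sym e))))))
... | inj₂ e = inj₁ (dominoes-symmetric (there (here (cong₂ _,_ refl (sym e)))))

straight-dominoes : EveryCopy (HasEdge dominoes) (+ 0 , + 0) (+ 1 , + 0) (+ 2 , + 0)
straight-dominoes (orient false false false) (tx , ty) = row-ascending tx _
straight-dominoes (orient false false true) (tx , ty) = row-ascending tx _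
straight-dominoes (orient false true false) (tx , ty) = row-descending tx _
straight-dominoes (orient false true true) (tx , ty) = row-descending tx _
straight-dominoes (orient true false false) (tx , ty) = column-ascending _ ty
straight-dominoes (orient true true false) (tx , ty) = column-ascending _ ty
straight-dominoes (orient true false true) (tx , ty) = column-descending _ ty
straight-dominoes (orient true true true) (tx , ty) = column-descending _ ty

L-horizontal : EveryCopy (HasEdge horizontal) (+ 0 , + 0) (+ 1 , + 0) (+ 0 , + 1)
L-horizontal = everyCopyHasEdge horizontal horizontal-invariant (+ 0 , + 0) (+ 1 , + 0) (+ 0 , + 1)

straight-centre : EveryCopy (HasCentre grid) (+ 0 , + 0) (+ 1 , + 0) (+ 2 , + 0)
straight-centre = everyCopyHasCentre grid grid-invariant (+ 0 , + 0) (+ 1 , + 0) (+ 2 , + 0)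

L-centre : EveryCopy (HasCentre grid) (+ 0 , + 0) (+ 1 , + 0) (+ 0 , + 1)
L-centre = everyCopyHasCentre grid grid-invariant (+ 0 , + 0) (+ 1 , + 0) (+ 0 , + 1)

straight-fork₁ straight-fork₂ : Fork P31
straight-fork₁ = fork P31 (+ 1 , + 0) (-[1+ 0 ] , + 0) (+ 2 , + 0)
straight-fork₂ = fork P31 (+ 0 , + 1) (+ 0 , -[1+ 0 ]) (+ 0 , + 2)

L-fork₁ L-fork₂ : Fork P32
L-fork₁ = fork P32 (+ 1 , + 0) (+ 0 , + 1) (+ 0 , -[1+ 0 ])
L-fork₂ = fork P32 (-[1+ 0 ] , + 0) (-[1+ 0 ] , + 1) (-[1+ 0 ] , -[1+ 0 ])

-- Maker's (2,7) opening: two far apart cells, each the end of four copies.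
opening : List Cell
opening = (+ 0 , + 0) ∷ (+ 10 , + 0) ∷ []

straight-arms : List (List Cell)
straight-arms =
  ((-[1+ 1 ] , + 0) ∷ (-[1+ 0 ] , + 0) ∷ []) ∷ ((+ 1 , + 0) ∷ (+ 2 , + 0) ∷ []) ∷
  ((+ 0 , -[1+ 1 ]) ∷ (+ 0 , -[1+ 0 ]) ∷ []) ∷ ((+ 0 , + 1) ∷ (+ 0 , + 2) ∷ []) ∷
  ((+ 8 , + 0) ∷ (+ 9 , + 0) ∷ []) ∷ ((+ 11 , + 0) ∷ (+ 12 , + 0) ∷ []) ∷
  ((+ 10 , -[1+ 1 ]) ∷ (+ 10 , -[1+ 0 ]) ∷ []) ∷ ((+ 10 , + 1) ∷ (+ 10 , + 2) ∷ []) ∷ []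

L-arms : List (List Cell)
L-arms =
  ((+ 1 , + 0) ∷ (+ 1 , + 1) ∷ []) ∷ ((+ 0 , + 1) ∷ (-[1+ 0 ] , + 1) ∷ []) ∷
  ((-[1+ 0 ] , + 0) ∷ (-[1+ 0 ] , -[1+ 0 ]) ∷ []) ∷ ((+ 0 , -[1+ 0 ]) ∷ (+ 1 , -[1+ 0 ]) ∷ []) ∷
  ((+ 11 , + 0) ∷ (+ 11 , + 1) ∷ []) ∷ ((+ 10 , + 1) ∷ (+ 9 , + 1) ∷ []) ∷
  ((+ 9 , + 0) ∷ (+ 9 , -[1+ 0 ]) ∷ []) ∷ ((+ 10 , -[1+ 0 ]) ∷ (+ 11 , -[1+ 0 ]) ∷ []) ∷ []

theorem7p2 : Tau1-7-∞ P31 × Tau1-7-∞ P32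
theorem7p2 =
  ( forkWin straight-fork₁ straight-fork₂ (from-yes (disjoint? (Fork.cells straight-fork₁) (Fork.cells straight-fork₂)))
  , edgeBreaker dominoes dominoes-symmetric dominoes-irreflexive dominoes-degree straight-dominoes
  , disjointCompletionsWin opening (from-yes (validMove? 2 [] opening)) straight-arms
      (completions 2 P31 opening straight-arms) (from-yes (allPairs? disjoint? straight-arms)) ℕₚ.≤-refl
  , centreBreaker grid grid-symmetric grid-irreflexive grid-degree straight-centre
  , λ n b n≥3 → winInOneMove P31 n≥3 )
  ,
  ( forkWin L-fork₁ L-fork₂ (from-yes (disjoint? (Fork.cells L-fork₁) (Fork.cells L-fork₂)))
  , edgeBreaker horizontal horizontal-symmetric horizontal-irreflexive horizontal-degree L-horizontal
  , disjointCompletionsWin opening (from-yes (validMove? 2 [] opening)) L-arms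
      (completions 2 P32 opening L-arms) (from-yes (allPairs? disjoint? L-arms)) ℕₚ.≤-refl
  , centreBreaker grid grid-symmetric grid-irreflexive grid-degree L-centre
  , λ n b n≥3 → winInOneMove P32 n≥3 )
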